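{- For every positive integer $n$, $$\Phi^{(1)}[aq^n; b, b'; c; x, y] = \sum_{k=0}^n \sum_{i=0}^k \begin{bmatrix} n \\ k \end{bmatrix} \begin{bmatrix} k \\ i \end{bmatrix} \frac{(b; q)_{k-i} (b'; q)_i}{(c; q)_k} q^{2\binom{k}{2}} a^k x^{k-i} y^i\, \Phi^{(1)}[aq^k; bq^{k-i}, b'q^i; cq^k; xq^i, y],$$ and $$\Phi^{(1)}[aq^{ -n}; b, b'; c; x, y] = \sum_{k=0}^n \sum_{i=0}^k \begin{bmatrix} n \\ k \end{bmatrix} \begin{bmatrix} k \\ i \end{bmatrix} \frac{(b; q)_{k-i} (b'; q)_i}{(c; q)_k} q^{\binom{k}{2} - nk} (-a)^k x^{k-i} y^i\, \Phi^{(1)}[a; bq^{k-i}, b'q^i; cq^k; xq^i, y].$$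
   Context: Let $q$ be a complex number with $|q|<1$. For a complex number $z$ and an integer $N\ge 0$, $(z;q)_N=\prod_{j=0}^{N-1}(1-zq^j)$. The $q$-binomial coefficient is $\begin{bmatrix} n \\ k \end{bmatrix}=\frac{(q;q)_n}{(q;q)_k(q;q)_{n-k}}$ for $0\le k\le n$, and $\binom{k}{2}=k(k-1)/2$. The $q$-Appell function $\Phi^{(1)}$ is $$\Phi^{(1)}[a; b, b'; c; x, y] = \sum_{m, n \geq 0} \frac{(a; q)_{m+n} (b; q)_m (b'; q)_n}{(q; q)_m (q; q)_n (c; q)_{m+n}} x^m y^n .$$ All identities are understood as identities of power series in $x,y$ (convergent for $|x|,|y|$ sufficiently small), with parameters generic so that no denominator appearing vanishes. -}

module Defs where

open import Level using (Level; _⊔_) renaming (suc to lsuc)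
open import Algebra.Bundles using (CommutativeRing)
open import Data.Nat using (ℕ; zero; suc; _∸_) renaming (_+_ to _+ℕ_)
open import Relation.Nullary using (¬_)

-- A field: a commutative ring with 0 ≠ 1 and a (congruent) inverse
-- operation that is a two-sided inverse on every nonzero element.
-- (The value of _⁻¹ at 0 is irrelevant.)  ℂ is an instance.
record Field (c ℓ : Level) : Set (lsuc (c ⊔ ℓ)) where
  field
    commutativeRing : CommutativeRing c ℓ
  open CommutativeRing commutativeRing public
  field
    _⁻¹     : Carrier → Carrier
    ⁻¹-cong : ∀ {x y} → x ≈ y → x ⁻¹ ≈ y ⁻¹
    ⁻¹-inv  : ∀ x → ¬ (x ≈ 0#) → x * x ⁻¹ ≈ 1#
    0≉1     : ¬ (0# ≈ 1#)

module FieldOps {c ℓ : Level} (F : Field c ℓ) where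
  open Field F using (Carrier; _≈_; _+_; _*_; _-_; 0#; 1#; _⁻¹)

  pow : Carrier → ℕ → Carrier
  pow x zero    = 1#
  pow x (suc n) = x * pow x n

  sumTo : ℕ → (ℕ → Carrier) → Carrier
  sumTo zero    f = f zero
  sumTo (suc n) f = sumTo n f + f (suc n)

  prodBelow : ℕ → (ℕ → Carrier) → Carrier
  prodBelow zero    f = 1#
  prodBelow (suc N) f = prodBelow N f * f N

  poch : Carrier → Carrier → ℕ → Carrier
  poch z q N = prodBelow N (λ j → 1# - z * pow q j)

  -- q-binomial coefficient [n k] = (q;q)_n / ((q;q)_k (q;q)_{n-k})  (used for k ≤ n)
  qbin : Carrier → ℕ → ℕ → Carrier
  qbin q n k = poch q q n * (poch q q k) ⁻¹ * (poch q q (n ∸ k)) ⁻¹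

  -- formal power series in two variables x, y: s m n = coefficient of x^m y^n
  Series : Set c
  Series = ℕ → ℕ → Carrier

  _≋_ : Series → Series → Set ℓ
  s ≋ t = ∀ m n → s m n ≈ t m n

  scaleS : Carrier → Series → Series
  scaleS r s m n = r * s m n

  -- multiplication by x^t
  shiftX : ℕ → Series → Series
  shiftX zero    s m       n = s m n
  shiftX (suc t) s zero    n = 0#
  shiftX (suc t) s (suc m) n = shiftX t s m n

  -- multiplication by y^t
  shiftY : ℕ → Series → Series
  shiftY zero    s m n       = s m n
  shiftY (suc t) s m zero    = 0#
  shiftY (suc t) s m (suc n) = shiftY t s m n

  -- substitution x ↦ r x
  dilateX : Carrier → Series → Series
  dilateX r s m n = pow r m * s m n

  sumS : ℕ → (ℕ → Series) → Series
  sumS n f m l = sumTo n (λ k → f k m l)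

  Φ1 : (a b b' c q : Carrier) → Series
  Φ1 a b b' c q m n =
    poch a q (m +ℕ n) * poch b q m * poch b' q n
      * (poch q q m * poch q q n * poch c q (m +ℕ n)) ⁻¹

module Submission where

-- Everything is compared coefficientwise.  The coefficient of x^m y^r in
-- Φ⁽¹⁾[A; b, b'; c] is  K(m,r) · (A;q)_{m+r}  with
-- K(m,r) = (b;q)_m (b';q)_r / ((q;q)_m (q;q)_r (c;q)_{m+r}),  so the only
-- dependence on the first parameter A is through the Pochhammer symbol
-- (A;q)_N, N = m + r.

open import Defs
open import Level using (Level)
open import Data.Nat using (ℕ; suc; _∸_; _≤_) renaming (_*_ to _*ℕ_)
open import Data.Nat.Combinatorics using (_C_)
open import Data.Product using (_×_; _,_)
open import Relation.Nullary using (¬_)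

open import Algebra.Bundles using (CommutativeRing)
open import Data.Nat using (zero; pred; _<_; z≤n; s≤s) renaming (_+_ to _+ℕ_)
import Data.Nat.Properties as ℕₚ
open import Data.Nat.Combinatorics using (nCk+nC[k+1]≡[n+1]C[k+1]; nC1≡n)
open import Relation.Nullary using (yes; no; contradiction)
import Relation.Binary.PropositionalEquality as P
open P using (_≡_)

-- Algebra.Solver.Ring decides ring identities with coefficients drawn from
-- a ring mapped homomorphically into the target.  Interpreting an integer n
-- as n·1 gives such a map into every commutative ring; with integer
-- coefficients normal forms are canonical, so cancellations are detected.
module IntegerCoefficientSolver {c ℓ : Level} (CR : CommutativeRing c ℓ) where
  open CommutativeRing CR
  open import Data.Maybe using (Maybe; just; nothing)
  open import Data.Integer as ℤ using (ℤ; +_; -[1+_]; _⊖_; _◃_)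
  import Data.Integer.Properties as ℤₚ
  open import Data.Sign as Sign using (Sign)
  open import Algebra.Properties.Semiring.Mult.TCOptimised semiring
    using (×-homo-+; ×1-homo-*) renaming (_×_ to _⋆_)
  open import Algebra.Properties.Ring ring using (-‿distribˡ-*; -‿distribʳ-*)
  open import Algebra.Properties.AbelianGroup +-abelianGroup
    using (⁻¹-∙-comm; ⁻¹-involutive; ε⁻¹≈ε)
  open import Algebra.Solver.Ring.AlmostCommutativeRing
  open import Relation.Binary.Reasoning.Setoid setoid

  ⟦_⟧ℤ : ℤ → Carrier
  ⟦ + n ⟧ℤ      = n ⋆ 1#
  ⟦ -[1+ n ] ⟧ℤ = - (suc n ⋆ 1#)

  sub-cancel-1+ : ∀ x y → x - y ≈ (1# + x) - (1# + y)
  sub-cancel-1+ x y = begin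
    x - y                  ≈⟨ sym (+-identityˡ _) ⟩
    0# + (x - y)           ≈⟨ +-congʳ (sym (-‿inverseʳ 1#)) ⟩
    (1# - 1#) + (x - y)    ≈⟨ +-assoc _ _ _ ⟩
    1# + (- 1# + (x - y))  ≈⟨ +-congˡ (sym (+-assoc _ _ _)) ⟩
    1# + ((- 1# + x) - y)  ≈⟨ +-congˡ (+-congʳ (+-comm _ _)) ⟩
    1# + ((x - 1#) - y)    ≈⟨ +-congˡ (+-assoc _ _ _) ⟩
    1# + (x + (- 1# - y))  ≈⟨ +-congˡ (+-congˡ (⁻¹-∙-comm 1# y)) ⟩
    1# + (x + - (1# + y))  ≈⟨ sym (+-assoc _ _ _) ⟩
    (1# + x) - (1# + y)    ∎

  ⊖-homo : ∀ m n → ⟦ m ⊖ n ⟧ℤ ≈ m ⋆ 1# - n ⋆ 1#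
  ⊖-homo m       zero    = sym (trans (+-congˡ ε⁻¹≈ε) (+-identityʳ _))
  ⊖-homo zero    (suc n) = sym (+-identityˡ _)
  ⊖-homo (suc m) (suc n) = begin
    ⟦ suc m ⊖ suc n ⟧ℤ                ≡⟨ P.cong ⟦_⟧ℤ (ℤₚ.[1+m]⊖[1+n]≡m⊖n m n) ⟩
    ⟦ m ⊖ n ⟧ℤ                        ≈⟨ ⊖-homo m n ⟩
    m ⋆ 1# - n ⋆ 1#                   ≈⟨ sub-cancel-1+ (m ⋆ 1#) (n ⋆ 1#) ⟩
    (1# + m ⋆ 1#) - (1# + n ⋆ 1#)     ≈⟨ sym (+-cong (×-homo-+ 1# 1 m) (-‿cong (×-homo-+ 1# 1 n))) ⟩
    suc m ⋆ 1# - suc n ⋆ 1#           ∎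

  -‿homo : ∀ i → ⟦ ℤ.- i ⟧ℤ ≈ - ⟦ i ⟧ℤ
  -‿homo (+ zero)  = sym ε⁻¹≈ε
  -‿homo (+ suc n) = refl
  -‿homo -[1+ n ]  = sym (⁻¹-involutive _)

  +-homo : ∀ i j → ⟦ i ℤ.+ j ⟧ℤ ≈ ⟦ i ⟧ℤ + ⟦ j ⟧ℤ
  +-homo (+ m)    (+ n)    = ×-homo-+ 1# m n
  +-homo (+ m)    -[1+ n ] = ⊖-homo m (suc n)
  +-homo -[1+ m ] (+ n)    = trans (⊖-homo n (suc m)) (+-comm _ _)
  +-homo -[1+ m ] -[1+ n ] = begin
    - (suc (suc (m +ℕ n)) ⋆ 1#)  ≡⟨ P.cong (λ t → - (t ⋆ 1#)) (P.sym (ℕₚ.+-suc (suc m) n)) ⟩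
    - ((suc m +ℕ suc n) ⋆ 1#)      ≈⟨ -‿cong (×-homo-+ 1# (suc m) (suc n)) ⟩
    - (suc m ⋆ 1# + suc n ⋆ 1#)    ≈⟨ sym (⁻¹-∙-comm _ _) ⟩
    - (suc m ⋆ 1#) + - (suc n ⋆ 1#) ∎

  private
    neg-sign : ∀ k → ⟦ Sign.- ◃ k ⟧ℤ ≈ - (k ⋆ 1#)
    neg-sign k = trans (P.subst (λ t → ⟦ Sign.- ◃ k ⟧ℤ ≈ ⟦ t ⟧ℤ) (ℤₚ.-◃n≡-n k) refl) (-‿homo (+ k))

    neg*neg : ∀ x y → - x * - y ≈ x * y
    neg*neg x y = trans (sym (-‿distribˡ-* x (- y)))
                        (trans (-‿cong (sym (-‿distribʳ-* x y))) (⁻¹-involutive _))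

  *-homo : ∀ i j → ⟦ i ℤ.* j ⟧ℤ ≈ ⟦ i ⟧ℤ * ⟦ j ⟧ℤ
  *-homo (+ m) (+ n) =
    trans (P.subst (λ t → ⟦ Sign.+ ◃ (m *ℕ n) ⟧ℤ ≈ ⟦ t ⟧ℤ) (ℤₚ.+◃n≡+n (m *ℕ n)) refl)
          (×1-homo-* m n)
  *-homo (+ m) -[1+ n ] =
    trans (neg-sign (m *ℕ suc n)) (trans (-‿cong (×1-homo-* m (suc n))) (-‿distribʳ-* _ _))
  *-homo -[1+ m ] (+ n) =
    trans (neg-sign (suc m *ℕ n)) (trans (-‿cong (×1-homo-* (suc m) n)) (-‿distribˡ-* _ _))
  *-homo -[1+ m ] -[1+ n ] = trans (×1-homo-* (suc m) (suc n)) (sym (neg*neg _ _))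

  ℤ-morphism : ℤ.+-*-rawRing -Raw-AlmostCommutative⟶ fromCommutativeRing CR
  ℤ-morphism = record
    { ⟦_⟧ = ⟦_⟧ℤ ; +-homo = +-homo ; *-homo = *-homo ; -‿homo = -‿homo
    ; 0-homo = refl ; 1-homo = refl }

  -- equal integers have equal images (the solver only needs this direction)
  ℤ-equal? : ∀ i j → Maybe (⟦ i ⟧ℤ ≈ ⟦ j ⟧ℤ)
  ℤ-equal? i j with i ℤ.≟ j
  ... | yes P.refl = just refl
  ... | no _       = nothing

  open import Algebra.Solver.Ring ℤ.+-*-rawRing (fromCommutativeRing CR) ℤ-morphism ℤ-equal? public
    using (solve; Polynomial; con; _:+_; _:*_; _:-_; :-_; _:=_)

  :0 :1 : ∀ {n} → Polynomial n
  :0 = con (+ 0)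
  :1 = con (+ 1)

module Exponents where
  open import Data.Nat.Solver using (module +-*-Solver)
  open +-*-Solver
  open P.≡-Reasoning
  open ℕₚ using (m∸n+n≡m; m+[n∸m]≡n; m+n∸m≡n)

  C2-suc : ∀ k → suc k C 2 ≡ k +ℕ k C 2
  C2-suc k = P.trans (P.sym (nCk+nC[k+1]≡[n+1]C[k+1] k 1)) (P.cong (_+ℕ k C 2) (nC1≡n k))

  double-C2-suc : ∀ k → 2 *ℕ (suc k C 2) ≡ 2 *ℕ (k C 2) +ℕ (k +ℕ k)
  double-C2-suc k = P.trans (P.cong (2 *ℕ_) (C2-suc k))
    (solve 2 (λ k c → con 2 :* (k :+ c) := con 2 :* c :+ (k :+ k)) P.refl k (k C 2))

  ∸-split : ∀ m r k i → i ≤ k → k ∸ i ≤ m → i ≤ r →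
            (m +ℕ r) ∸ k ≡ (m ∸ (k ∸ i)) +ℕ (r ∸ i)
  ∸-split m r k i i≤k j≤m i≤r = begin
    (m +ℕ r) ∸ k                    ≡⟨ P.cong ((m +ℕ r) ∸_) (P.sym (m∸n+n≡m i≤k)) ⟩
    (m +ℕ r) ∸ (j +ℕ i)             ≡⟨ P.cong₂ (λ x y → (x +ℕ y) ∸ (j +ℕ i))
                                         (P.sym (m+[n∸m]≡n j≤m)) (P.sym (m+[n∸m]≡n i≤r)) ⟩
    ((j +ℕ m') +ℕ (i +ℕ r')) ∸ (j +ℕ i)
      ≡⟨ P.cong (_∸ (j +ℕ i)) (solve 4 (λ j m' i r' → (j :+ m') :+ (i :+ r') := (j :+ i) :+ (m' :+ r'))
                                  P.refl j m' i r') ⟩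
    ((j +ℕ i) +ℕ (m' +ℕ r')) ∸ (j +ℕ i) ≡⟨ m+n∸m≡n (j +ℕ i) (m' +ℕ r') ⟩
    m' +ℕ r'                        ∎
    where
    j = k ∸ i
    m' = m ∸ j
    r' = r ∸ i

  -- The exponent identity behind the induction step of q-Vandermonde.
  vandermonde-exponent : ∀ m r k i → i ≤ k → k ∸ i ≤ m → i ≤ r →
    (r ∸ i) +ℕ suc i *ℕ (m ∸ (k ∸ i)) ≡ i *ℕ (m ∸ (k ∸ i)) +ℕ ((m +ℕ r) ∸ k)
  vandermonde-exponent m r k i i≤k j≤m i≤r = begin
    r' +ℕ suc i *ℕ m'         ≡⟨ solve 3 (λ i m' r' → r' :+ (con 1 :+ i) :* m' := i :* m' :+ (m' :+ r'))
                                    P.refl i m' r' ⟩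
    i *ℕ m' +ℕ (m' +ℕ r')     ≡⟨ P.cong (i *ℕ m' +ℕ_) (P.sym (∸-split m r k i i≤k j≤m i≤r)) ⟩
    i *ℕ m' +ℕ ((m +ℕ r) ∸ k) ∎
    where
    m' = m ∸ (k ∸ i)
    r' = r ∸ i

  k≤m+r : ∀ m r k i → i ≤ k → k ∸ i ≤ m → i ≤ r → k ≤ m +ℕ r
  k≤m+r m r k i i≤k j≤m i≤r = P.subst (_≤ m +ℕ r) (m∸n+n≡m i≤k) (ℕₚ.+-mono-≤ j≤m i≤r)

module FieldFacts {c ℓ : Level} (F : Field c ℓ) where
  open Field F hiding (zero)
  open FieldOps F
  open IntegerCoefficientSolver commutativeRing public
  open import Relation.Binary.Reasoning.Setoid setoid public

  pow-cong : ∀ {x y} n → x ≈ y → pow x n ≈ pow y n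
  pow-cong zero    e = refl
  pow-cong (suc n) e = *-cong e (pow-cong n e)

  pow-+ : ∀ x m n → pow x (m +ℕ n) ≈ pow x m * pow x n
  pow-+ x zero    n = sym (*-identityˡ _)
  pow-+ x (suc m) n = trans (*-congˡ (pow-+ x m n)) (sym (*-assoc _ _ _))

  pow-* : ∀ x y n → pow (x * y) n ≈ pow x n * pow y n
  pow-* x y zero    = sym (*-identityˡ _)
  pow-* x y (suc n) = begin
    x * y * pow (x * y) n          ≈⟨ *-congˡ (pow-* x y n) ⟩
    x * y * (pow x n * pow y n)    ≈⟨ solve 4 (λ x y a b → x :* y :* (a :* b) := x :* a :* (y :* b))
                                        refl x y (pow x n) (pow y n) ⟩
    x * pow x n * (y * pow y n)    ∎

  pow-pow : ∀ x m n → pow (pow x m) n ≈ pow x (m *ℕ n)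
  pow-pow x m zero    = P.subst (λ t → 1# ≈ pow x t) (P.sym (ℕₚ.*-zeroʳ m)) refl
  pow-pow x m (suc n) = begin
    pow x m * pow (pow x m) n    ≈⟨ *-congˡ (pow-pow x m n) ⟩
    pow x m * pow x (m *ℕ n)     ≈⟨ sym (pow-+ x m (m *ℕ n)) ⟩
    pow x (m +ℕ m *ℕ n)          ≡⟨ P.cong (pow x) (P.sym (ℕₚ.*-suc m n)) ⟩
    pow x (m *ℕ suc n)           ∎

  pow-1# : ∀ n → pow 1# n ≈ 1#
  pow-1# zero    = refl
  pow-1# (suc n) = trans (*-identityˡ _) (pow-1# n)

  sum-cong≤ : ∀ n {f g : ℕ → Carrier} → (∀ k → k ≤ n → f k ≈ g k) → sumTo n f ≈ sumTo n g
  sum-cong≤ zero    e = e 0 z≤n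
  sum-cong≤ (suc n) e = +-cong (sum-cong≤ n (λ k k≤n → e k (ℕₚ.m≤n⇒m≤1+n k≤n))) (e (suc n) ℕₚ.≤-refl)

  sum-cong : ∀ n {f g : ℕ → Carrier} → (∀ k → f k ≈ g k) → sumTo n f ≈ sumTo n g
  sum-cong n e = sum-cong≤ n (λ k _ → e k)

  sum-first : ∀ n (f : ℕ → Carrier) → sumTo (suc n) f ≈ f 0 + sumTo n (λ k → f (suc k))
  sum-first zero    f = refl
  sum-first (suc n) f = trans (+-congʳ (sum-first n f)) (+-assoc _ _ _)

  sum-+ : ∀ n (f g : ℕ → Carrier) → sumTo n (λ k → f k + g k) ≈ sumTo n f + sumTo n g
  sum-+ zero    f g = refl
  sum-+ (suc n) f g = trans (+-congʳ (sum-+ n f g))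
    (solve 4 (λ a b c d → a :+ b :+ (c :+ d) := a :+ c :+ (b :+ d)) refl _ _ _ _)

  sum-*ˡ : ∀ n x (f : ℕ → Carrier) → x * sumTo n f ≈ sumTo n (λ k → x * f k)
  sum-*ˡ zero    x f = refl
  sum-*ˡ (suc n) x f = trans (distribˡ _ _ _) (+-congʳ (sum-*ˡ n x f))

  sum-0 : ∀ n (f : ℕ → Carrier) → (∀ k → k ≤ n → f k ≈ 0#) → sumTo n f ≈ 0#
  sum-0 zero    f e = e 0 z≤n
  sum-0 (suc n) f e =
    trans (+-cong (sum-0 n f (λ k k≤n → e k (ℕₚ.m≤n⇒m≤1+n k≤n))) (e (suc n) ℕₚ.≤-refl)) (+-identityʳ _)

  resum : ∀ n (A B H Z : ℕ → Carrier) → A (suc n) ≈ 0# →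
          H 0 ≈ A 0 → (∀ k → H (suc k) ≈ A (suc k) + B k) →
          sumTo n (λ k → A k * Z k + B k * Z (suc k)) ≈ sumTo (suc n) (λ k → H k * Z k)
  resum n A B H Z top h0 hsuc = begin
    sumTo n (λ k → a k + b k)                              ≈⟨ sum-+ n a b ⟩
    sumTo n a + sumTo n b                                  ≈⟨ +-congʳ (sym add-top) ⟩
    sumTo (suc n) a + sumTo n b                            ≈⟨ +-congʳ (sum-first n a) ⟩
    (a 0 + sumTo n (λ k → a (suc k))) + sumTo n b          ≈⟨ +-assoc _ _ _ ⟩
    a 0 + (sumTo n (λ k → a (suc k)) + sumTo n b)          ≈⟨ +-congˡ (sym (sum-+ n (λ k → a (suc k)) b)) ⟩
    a 0 + sumTo n (λ k → a (suc k) + b k)                  ≈⟨ +-cong (*-congʳ (sym h0))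
                                                                (sum-cong n (λ k → trans (sym (distribʳ _ _ _))
                                                                                          (*-congʳ (sym (hsuc k))))) ⟩
    H 0 * Z 0 + sumTo n (λ k → H (suc k) * Z (suc k))      ≈⟨ sym (sum-first n (λ k → H k * Z k)) ⟩
    sumTo (suc n) (λ k → H k * Z k)                        ∎
    where
    a b : ℕ → Carrier
    a k = A k * Z k
    b k = B k * Z (suc k)
    add-top : sumTo (suc n) a ≈ sumTo n a
    add-top = trans (+-congˡ (trans (*-congʳ top) (zeroˡ _))) (+-identityʳ _)

  prod-cong : ∀ N {f g : ℕ → Carrier} → (∀ j → f j ≈ g j) → prodBelow N f ≈ prodBelow N g
  prod-cong zero    e = refl
  prod-cong (suc N) e = *-cong (prod-cong N e) (e N)

  poch-cong : ∀ {z z'} q N → z ≈ z' → poch z q N ≈ poch z' q N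
  poch-cong q N e = prod-cong N (λ j → +-congˡ (-‿cong (*-congʳ e)))

  poch-+ : ∀ z q s t → poch z q (s +ℕ t) ≈ poch z q s * poch (z * pow q s) q t
  poch-+ z q s zero =
    P.subst (λ u → poch z q u ≈ poch z q s * 1#) (P.sym (ℕₚ.+-identityʳ s)) (sym (*-identityʳ _))
  poch-+ z q s (suc t) = begin
    poch z q (s +ℕ suc t)
      ≡⟨ P.cong (poch z q) (ℕₚ.+-suc s t) ⟩
    poch z q (s +ℕ t) * (1# - z * pow q (s +ℕ t))
      ≈⟨ *-cong (poch-+ z q s t) (+-congˡ (-‿cong (*-congˡ (pow-+ q s t)))) ⟩
    poch z q s * poch (z * pow q s) q t * (1# - z * (pow q s * pow q t))
      ≈⟨ *-assoc _ _ _ ⟩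
    poch z q s * (poch (z * pow q s) q t * (1# - z * (pow q s * pow q t)))
      ≈⟨ *-congˡ (*-congˡ (+-congˡ (-‿cong (sym (*-assoc _ _ _))))) ⟩
    poch z q s * poch (z * pow q s) q (suc t)
      ∎

  poch-∸ : ∀ z q s t → s ≤ t → poch z q t ≈ poch z q s * poch (z * pow q s) q (t ∸ s)
  poch-∸ z q s t s≤t =
    P.subst (λ u → poch z q u ≈ poch z q s * poch (z * pow q s) q (t ∸ s)) (ℕₚ.m+[n∸m]≡n s≤t) (poch-+ z q s (t ∸ s))

  poch-suc : ∀ z q M → poch z q (suc M) ≈ (1# - z) * poch (z * q) q M
  poch-suc z q M = begin
    poch z q (1 +ℕ M)                    ≈⟨ poch-+ z q 1 M ⟩
    poch z q 1 * poch (z * pow q 1) q M  ≈⟨ *-cong (solve 1 (λ z → :1 :* (:1 :- z :* :1) := :1 :- z) refl z)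
                                                    (poch-cong q M (*-congˡ (*-identityʳ q))) ⟩
    (1# - z) * poch (z * q) q M          ∎

  -- (w;q)_M + w (1 - q^M) (w q;q)_{M-1} = (w q;q)_M ; the single Pochhammer
  -- identity behind both recurrences of the expansions below.
  poch-absorb : ∀ w q M → poch w q M + w * (1# - pow q M) * poch (w * q) q (pred M) ≈ poch (w * q) q M
  poch-absorb w q zero    = solve 1 (λ w → :1 :+ w :* (:1 :- :1) :* :1 := :1) refl w
  poch-absorb w q (suc M) = begin
    poch w q (suc M) + w * (1# - q * v) * p    ≈⟨ +-congʳ (poch-suc w q M) ⟩
    (1# - w) * p + w * (1# - q * v) * p        ≈⟨ solve 4 (λ w q v p → (:1 :- w) :* p :+ w :* (:1 :- q :* v) :* p
                                                                    := p :* (:1 :- w :* q :* v)) refl w q v p ⟩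
    p * (1# - w * q * v)                       ∎
    where
    v = pow q M
    p = poch (w * q) q M

  nz-resp : ∀ {x y} → x ≈ y → ¬ (x ≈ 0#) → ¬ (y ≈ 0#)
  nz-resp e x≉0 y≈0 = x≉0 (trans e y≈0)

  nz-* : ∀ {x y} → ¬ (x ≈ 0#) → ¬ (y ≈ 0#) → ¬ (x * y ≈ 0#)
  nz-* {x} {y} x≉0 y≉0 xy≈0 = y≉0 (begin
    y                 ≈⟨ sym (*-identityˡ y) ⟩
    1# * y            ≈⟨ *-congʳ (sym (trans (*-comm _ _) (⁻¹-inv x x≉0))) ⟩
    x ⁻¹ * x * y      ≈⟨ *-assoc _ _ _ ⟩
    x ⁻¹ * (x * y)    ≈⟨ *-congˡ xy≈0 ⟩
    x ⁻¹ * 0#         ≈⟨ zeroʳ _ ⟩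
    0#                ∎)

  nz-factor : ∀ {x y z} → x * y ≈ z → ¬ (z ≈ 0#) → ¬ (x ≈ 0#)
  nz-factor {y = y} e z≉0 x≈0 = z≉0 (trans (sym e) (trans (*-congʳ x≈0) (zeroˡ y)))

  prod-nz : ∀ N (f : ℕ → Carrier) → (∀ j → ¬ (f j ≈ 0#)) → ¬ (prodBelow N f ≈ 0#)
  prod-nz zero    f h e = 0≉1 (sym e)
  prod-nz (suc N) f h   = nz-* (prod-nz N f h) (h N)

  inv-unique : ∀ {z w} → ¬ (z ≈ 0#) → z * w ≈ 1# → w ≈ z ⁻¹
  inv-unique {z} {w} z≉0 e = begin
    w              ≈⟨ sym (*-identityʳ w) ⟩
    w * 1#         ≈⟨ *-congˡ (sym (⁻¹-inv z z≉0)) ⟩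
    w * (z * z ⁻¹) ≈⟨ sym (*-assoc _ _ _) ⟩
    w * z * z ⁻¹   ≈⟨ *-congʳ (trans (*-comm _ _) e) ⟩
    1# * z ⁻¹      ≈⟨ *-identityˡ _ ⟩
    z ⁻¹           ∎

  inv-* : ∀ {x y} → ¬ (x ≈ 0#) → ¬ (y ≈ 0#) → (x * y) ⁻¹ ≈ x ⁻¹ * y ⁻¹
  inv-* {x} {y} x≉0 y≉0 = sym (inv-unique (nz-* x≉0 y≉0) (begin
    x * y * (x ⁻¹ * y ⁻¹)       ≈⟨ solve 4 (λ x y a b → x :* y :* (a :* b) := (x :* a) :* (y :* b))
                                     refl x y (x ⁻¹) (y ⁻¹) ⟩
    (x * x ⁻¹) * (y * y ⁻¹)     ≈⟨ *-cong (⁻¹-inv x x≉0) (⁻¹-inv y y≉0) ⟩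
    1# * 1#                     ≈⟨ *-identityˡ _ ⟩
    1#                          ∎))

-- Gaussian binomial coefficients, defined by the q-Pascal recurrence
--   G (n+1) (k+1) = q^{k+1} G n (k+1) + G n k,
-- which avoids division; they are identified with the q-binomial
-- coefficients of the statement once (q;q)_n is known to be nonzero.
module Gaussian {c ℓ : Level} (F : Field c ℓ) (q : Field.Carrier F) where
  open Field F hiding (zero)
  open FieldOps F
  open FieldFacts F

  gauss : ℕ → ℕ → Carrier
  gauss zero    zero    = 1#
  gauss zero    (suc k) = 0#
  gauss (suc n) zero    = 1#
  gauss (suc n) (suc k) = pow q (suc k) * gauss n (suc k) + gauss n k

  -- falling N k = ∏_{j<k} (1 - q^{N-j}) = (q;q)_N / (q;q)_{N-k}  for k ≤ N
  falling : ℕ → ℕ → Carrier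
  falling N k = prodBelow k (λ j → 1# - pow q (N ∸ j))

  gauss-0 : ∀ n → gauss n 0 ≈ 1#
  gauss-0 zero    = refl
  gauss-0 (suc n) = refl

  gauss-vanish : ∀ n k → n < k → gauss n k ≈ 0#
  gauss-vanish zero    (suc k) _         = refl
  gauss-vanish (suc n) (suc k) (s≤s n<k) = begin
    pow q (suc k) * gauss n (suc k) + gauss n k ≈⟨ +-cong (*-congˡ (gauss-vanish n (suc k) (ℕₚ.m<n⇒m<1+n n<k)))
                                                          (gauss-vanish n k n<k) ⟩
    pow q (suc k) * 0# + 0#                     ≈⟨ trans (+-identityʳ _) (zeroʳ _) ⟩
    0#                                          ∎

  gauss-absorb : ∀ n s → (1# - pow q (suc s)) * gauss n (suc s) ≈ (1# - pow q (n ∸ s)) * gauss n s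
  gauss-absorb n s with n ℕₚ.≤? s
  gauss-absorb n s | yes n≤s = begin
    (1# - pow q (suc s)) * gauss n (suc s)  ≈⟨ trans (*-congˡ (gauss-vanish n (suc s) (s≤s n≤s))) (zeroʳ _) ⟩
    0#                                      ≈⟨ sym (trans (*-congʳ (-‿inverseʳ 1#)) (zeroˡ _)) ⟩
    (1# - 1#) * gauss n s
      ≡⟨ P.cong (λ t → (1# - pow q t) * gauss n s) (P.sym (ℕₚ.m≤n⇒m∸n≡0 n≤s)) ⟩
    (1# - pow q (n ∸ s)) * gauss n s        ∎
  gauss-absorb zero    s       | no 0≰s = contradiction z≤n 0≰s
  gauss-absorb (suc n) zero    | no _   = begin
    (1# - q * 1#) * (q * 1# * gauss n 1 + gauss n 0)
      ≈⟨ *-congˡ (+-congˡ (gauss-0 n)) ⟩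
    (1# - q * 1#) * (q * 1# * gauss n 1 + 1#)
      ≈⟨ solve 2 (λ q g → (:1 :- q :* :1) :* (q :* :1 :* g :+ :1) := q :* ((:1 :- q :* :1) :* g) :+ (:1 :- q))
           refl q (gauss n 1) ⟩
    q * ((1# - q * 1#) * gauss n 1) + (1# - q)
      ≈⟨ +-congʳ (*-congˡ (trans (gauss-absorb n zero) (*-congˡ (gauss-0 n)))) ⟩
    q * ((1# - pow q n) * 1#) + (1# - q)
      ≈⟨ solve 2 (λ q w → q :* ((:1 :- w) :* :1) :+ (:1 :- q) := (:1 :- q :* w) :* :1) refl q (pow q n) ⟩
    (1# - pow q (suc n)) * 1#
      ∎
  gauss-absorb (suc n) (suc s) | no n≰s = begin
    (1# - q * u) * (q * u * G₂ + G₁)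
      ≈⟨ solve 4 (λ q u G₂ G₁ → (:1 :- q :* u) :* (q :* u :* G₂ :+ G₁)
                                 := q :* u :* ((:1 :- q :* u) :* G₂) :+ (:1 :- q :* u) :* G₁) refl q u G₂ G₁ ⟩
    q * u * ((1# - q * u) * G₂) + (1# - q * u) * G₁
      ≈⟨ +-congʳ (*-congˡ (gauss-absorb n (suc s))) ⟩
    q * u * ((1# - w) * G₁) + (1# - q * u) * G₁
      ≈⟨ solve 4 (λ q u w G₁ → q :* u :* ((:1 :- w) :* G₁) :+ (:1 :- q :* u) :* G₁
                                := (:1 :- q :* w) :* (u :* G₁) :+ (:1 :- u) :* G₁) refl q u w G₁ ⟩
    (1# - q * w) * (u * G₁) + (1# - u) * G₁
      ≈⟨ +-congˡ (gauss-absorb n s) ⟩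
    (1# - q * w) * (u * G₁) + (1# - pow q (n ∸ s)) * G₀
      ≡⟨ P.cong (λ t → (1# - q * w) * (u * G₁) + (1# - t) * G₀) q[n-s] ⟩
    (1# - q * w) * (u * G₁) + (1# - q * w) * G₀
      ≈⟨ sym (distribˡ _ _ _) ⟩
    (1# - q * w) * (u * G₁ + G₀)
      ≡⟨ P.cong (λ t → (1# - t) * (u * G₁ + G₀)) (P.sym q[n-s]) ⟩
    (1# - pow q (n ∸ s)) * (u * G₁ + G₀)
      ∎
    where
    u = pow q (suc s)
    w = pow q (n ∸ suc s)
    G₂ = gauss n (suc (suc s))
    G₁ = gauss n (suc s)
    G₀ = gauss n s
    q[n-s] : pow q (n ∸ s) ≡ q * w
    q[n-s] = P.cong (pow q) (ℕₚ.+-∸-assoc 1 (ℕₚ.≤-pred (ℕₚ.≰⇒> n≰s)))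

  gauss-pascal₂ : ∀ n k → gauss (suc n) (suc k) ≈ gauss n (suc k) + pow q (n ∸ k) * gauss n k
  gauss-pascal₂ n k = begin
    u * G₁ + G₀
      ≈⟨ solve 4 (λ u G₁ G₀ w → u :* G₁ :+ G₀ := G₁ :+ w :* G₀ :+ (((:1 :- w) :* G₀) :- (:1 :- u) :* G₁))
           refl u G₁ G₀ w ⟩
    G₁ + w * G₀ + ((1# - w) * G₀ - (1# - u) * G₁)
      ≈⟨ +-congˡ (+-congʳ (sym (gauss-absorb n k))) ⟩
    G₁ + w * G₀ + ((1# - u) * G₁ - (1# - u) * G₁)
      ≈⟨ trans (+-congˡ (-‿inverseʳ _)) (+-identityʳ _) ⟩
    G₁ + w * G₀
      ∎
    where
    u = pow q (suc k)
    w = pow q (n ∸ k)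
    G₁ = gauss n (suc k)
    G₀ = gauss n k

  gauss-falling : ∀ N k → gauss N k * poch q q k ≈ falling N k
  gauss-falling N zero    = trans (*-identityʳ _) (gauss-0 N)
  gauss-falling N (suc k) = begin
    gauss N (suc k) * (poch q q k * (1# - pow q (suc k)))
      ≈⟨ solve 3 (λ g p x → g :* (p :* x) := x :* g :* p) refl (gauss N (suc k)) (poch q q k) (1# - pow q (suc k)) ⟩
    (1# - pow q (suc k)) * gauss N (suc k) * poch q q k
      ≈⟨ *-congʳ (gauss-absorb N k) ⟩
    (1# - pow q (N ∸ k)) * gauss N k * poch q q k
      ≈⟨ trans (*-assoc _ _ _) (*-comm _ _) ⟩
    gauss N k * poch q q k * (1# - pow q (N ∸ k))
      ≈⟨ *-congʳ (gauss-falling N k) ⟩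
    falling N (suc k)
      ∎

  falling-poch : ∀ n k → k ≤ n → falling n k * poch q q (n ∸ k) ≈ poch q q n
  falling-poch n zero    _   = *-identityˡ _
  falling-poch n (suc k) k<n = begin
    falling n k * (1# - pow q (n ∸ k)) * poch q q (n ∸ suc k)
      ≈⟨ trans (*-assoc _ _ _) (*-congˡ (*-comm _ _)) ⟩
    falling n k * (poch q q (n ∸ suc k) * (1# - pow q (n ∸ k)))
      ≡⟨ P.cong (λ t → falling n k * (poch q q (n ∸ suc k) * (1# - pow q t))) n-k ⟩
    falling n k * poch q q (suc (n ∸ suc k))
      ≡⟨ P.cong (λ t → falling n k * poch q q t) (P.sym n-k) ⟩
    falling n k * poch q q (n ∸ k)
      ≈⟨ falling-poch n k (ℕₚ.<⇒≤ k<n) ⟩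
    poch q q n
      ∎
    where
    n-k : n ∸ k ≡ suc (n ∸ suc k)
    n-k = ℕₚ.+-∸-assoc 1 k<n

  gauss-poch : ∀ n k → k ≤ n → gauss n k * poch q q k * poch q q (n ∸ k) ≈ poch q q n
  gauss-poch n k k≤n = trans (*-congʳ (gauss-falling n k)) (falling-poch n k k≤n)

  vandermonde-term : ℕ → ℕ → ℕ → ℕ → Carrier
  vandermonde-term m r k i = gauss m (k ∸ i) * gauss r i * pow q (i *ℕ (m ∸ (k ∸ i)))

  private
    vanishing-factor : ∀ {g} x y z w → g ≈ 0# → g * x * y ≈ w * (g * z)
    vanishing-factor {g} x y z w g≈0 = begin
      g * x * y      ≈⟨ *-congʳ (*-congʳ g≈0) ⟩
      0# * x * y     ≈⟨ solve 4 (λ x y z w → :0 :* x :* y := w :* (:0 :* z)) refl x y z w ⟩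
      w * (0# * z)   ≈⟨ *-congˡ (*-congʳ (sym g≈0)) ⟩
      w * (g * z)    ∎

  -- the term of the sum for G (m+r+1) (k+1) produced by the Pascal rule for G (r+1)
  vandermonde-shift : ∀ m r k i → i ≤ k →
    gauss m (k ∸ i) * gauss r i * pow q (r ∸ i) * pow q (suc i *ℕ (m ∸ (k ∸ i)))
      ≈ pow q ((m +ℕ r) ∸ k) * vandermonde-term m r k i
  vandermonde-shift m r k i i≤k with (k ∸ i) ℕₚ.≤? m | i ℕₚ.≤? r
  ... | yes j≤m | yes i≤r = begin
    g * pow q (r ∸ i) * pow q (suc i *ℕ m')   ≈⟨ *-assoc _ _ _ ⟩
    g * (pow q (r ∸ i) * pow q (suc i *ℕ m')) ≈⟨ *-congˡ (sym (pow-+ q (r ∸ i) (suc i *ℕ m'))) ⟩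
    g * pow q ((r ∸ i) +ℕ suc i *ℕ m')
      ≡⟨ P.cong (λ t → g * pow q t) (Exponents.vandermonde-exponent m r k i i≤k j≤m i≤r) ⟩
    g * pow q (i *ℕ m' +ℕ ((m +ℕ r) ∸ k))     ≈⟨ *-congˡ (pow-+ q (i *ℕ m') ((m +ℕ r) ∸ k)) ⟩
    g * (pow q (i *ℕ m') * pow q ((m +ℕ r) ∸ k))
                                              ≈⟨ solve 3 (λ g a b → g :* (a :* b) := b :* (g :* a)) refl g _ _ ⟩
    pow q ((m +ℕ r) ∸ k) * (g * pow q (i *ℕ m')) ∎
    where
    g = gauss m (k ∸ i) * gauss r i
    m' = m ∸ (k ∸ i)
  ... | no j≰m | _ = vanishing-factor _ _ _ _
                       (trans (*-congʳ (gauss-vanish m (k ∸ i) (ℕₚ.≰⇒> j≰m))) (zeroˡ _))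
  ... | yes _ | no i≰r = vanishing-factor _ _ _ _
                       (trans (*-congˡ (gauss-vanish r i (ℕₚ.≰⇒> i≰r))) (zeroʳ _))

  q-vandermonde : ∀ m r k → sumTo k (vandermonde-term m r k) ≈ gauss (m +ℕ r) k
  q-vandermonde m zero    zero    =
    trans (trans (*-identityʳ _) (*-identityʳ _)) (trans (gauss-0 m) (sym (gauss-0 (m +ℕ 0))))
  q-vandermonde m zero    (suc k) = begin
    sumTo (suc k) (vandermonde-term m 0 (suc k))
      ≈⟨ sum-first k (vandermonde-term m 0 (suc k)) ⟩
    vandermonde-term m 0 (suc k) 0 + sumTo k (λ i → vandermonde-term m 0 (suc k) (suc i))
      ≈⟨ +-congˡ (sum-0 k _ (λ i _ → trans (*-congʳ (zeroʳ _)) (zeroˡ _))) ⟩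
    vandermonde-term m 0 (suc k) 0 + 0#
      ≈⟨ trans (+-identityʳ _) (trans (*-identityʳ _) (*-identityʳ _)) ⟩
    gauss m (suc k)
      ≡⟨ P.cong (λ t → gauss t (suc k)) (P.sym (ℕₚ.+-identityʳ m)) ⟩
    gauss (m +ℕ 0) (suc k)
      ∎
  q-vandermonde m (suc r) zero    =
    trans (trans (*-identityʳ _) (*-identityʳ _)) (trans (gauss-0 m) (sym (gauss-0 (m +ℕ suc r))))
  q-vandermonde m (suc r) (suc k) = begin
    sumTo (suc k) v
      ≈⟨ sum-first k v ⟩
    v 0 + sumTo k (λ i → v (suc i))
      ≈⟨ +-cong (*-congʳ (*-congˡ (sym (gauss-0 r))))
                (sum-cong k (λ i → trans (*-congʳ (*-congˡ (gauss-pascal₂ r i)))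
                   (solve 5 (λ A B₁ w B₀ E → A :* (B₁ :+ w :* B₀) :* E := A :* B₁ :* E :+ A :* B₀ :* w :* E)
                      refl _ _ _ _ _))) ⟩
    v′ 0 + sumTo k (λ i → v′ (suc i) + t i)
      ≈⟨ +-congˡ (sum-+ k (λ i → v′ (suc i)) t) ⟩
    v′ 0 + (sumTo k (λ i → v′ (suc i)) + sumTo k t)
      ≈⟨ sym (+-assoc _ _ _) ⟩
    (v′ 0 + sumTo k (λ i → v′ (suc i))) + sumTo k t
      ≈⟨ +-cong (sym (sum-first k v′)) (sum-cong≤ k (λ i i≤k → vandermonde-shift m r k i i≤k)) ⟩
    sumTo (suc k) v′ + sumTo k (λ i → pow q ((m +ℕ r) ∸ k) * vandermonde-term m r k i)
      ≈⟨ +-cong (q-vandermonde m r (suc k)) (sym (sum-*ˡ k _ (vandermonde-term m r k))) ⟩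
    gauss (m +ℕ r) (suc k) + pow q ((m +ℕ r) ∸ k) * sumTo k (vandermonde-term m r k)
      ≈⟨ +-congˡ (*-congˡ (q-vandermonde m r k)) ⟩
    gauss (m +ℕ r) (suc k) + pow q ((m +ℕ r) ∸ k) * gauss (m +ℕ r) k
      ≈⟨ sym (gauss-pascal₂ (m +ℕ r) k) ⟩
    gauss (suc (m +ℕ r)) (suc k)
      ≡⟨ P.cong (λ t → gauss t (suc k)) (P.sym (ℕₚ.+-suc m r)) ⟩
    gauss (m +ℕ suc r) (suc k)
      ∎
    where
    v v′ : ℕ → Carrier
    v = vandermonde-term m (suc r) (suc k)
    v′ = vandermonde-term m r (suc k)
    t : ℕ → Carrier
    t i = gauss m (k ∸ i) * gauss r i * pow q (r ∸ i) * pow q (suc i *ℕ (m ∸ (k ∸ i)))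

-- Both follow by induction on n: a three-term recurrence for the summands
-- (a consequence of poch-absorb) is resummed with the q-Pascal rules.
module Expansions {c ℓ : Level} (F : Field c ℓ) (q : Field.Carrier F) where
  open Field F hiding (zero)
  open FieldOps F
  open FieldFacts F
  open Gaussian F q

  pow-double-C2-suc : ∀ k → pow q (2 *ℕ (suc k C 2)) ≈ pow q (2 *ℕ (k C 2)) * (pow q k * pow q k)
  pow-double-C2-suc k = begin
    pow q (2 *ℕ (suc k C 2))                    ≡⟨ P.cong (pow q) (Exponents.double-C2-suc k) ⟩
    pow q (2 *ℕ (k C 2) +ℕ (k +ℕ k))            ≈⟨ pow-+ q (2 *ℕ (k C 2)) (k +ℕ k) ⟩
    pow q (2 *ℕ (k C 2)) * pow q (k +ℕ k)       ≈⟨ *-congˡ (pow-+ q k k) ⟩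
    pow q (2 *ℕ (k C 2)) * (pow q k * pow q k)  ∎

  pow-C2-suc : ∀ k → pow q (suc k C 2) ≈ pow q (k C 2) * pow q k
  pow-C2-suc k = begin
    pow q (suc k C 2)          ≡⟨ P.cong (pow q) (P.trans (Exponents.C2-suc k) (ℕₚ.+-comm k (k C 2))) ⟩
    pow q (k C 2 +ℕ k)         ≈⟨ pow-+ q (k C 2) k ⟩
    pow q (k C 2) * pow q k    ∎

  -- (z t q;q)_{N-k-1} as an instance of the (w q;q)_{pred M} of poch-absorb
  poch-next : ∀ z t N k → poch (z * (q * t)) q (N ∸ suc k) ≈ poch (z * t * q) q (pred (N ∸ k))
  poch-next z t N k = P.subst (λ s → poch (z * (q * t)) q (N ∸ suc k) ≈ poch (z * t * q) q s)
                        (P.sym (ℕₚ.pred[m∸n]≡m∸[1+n] N k))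
                        (poch-cong q (N ∸ suc k) (solve 3 (λ z q t → z :* (q :* t) := z :* t :* q) refl z q t))

  term₁ : ℕ → Carrier → ℕ → Carrier
  term₁ N a k = pow q (2 *ℕ (k C 2)) * pow a k * falling N k * poch (a * pow q k) q (N ∸ k)

  term₁-recurrence : ∀ N a k → pow q k * term₁ N a k + term₁ N a (suc k) ≈ term₁ N (a * q) k
  term₁-recurrence N a k = begin
    u * (Z * A * Fk * poch w q M) + pow q (2 *ℕ (suc k C 2)) * (a * A) * (Fk * (1# - pow q M)) * p′
      ≈⟨ +-congˡ (*-cong (*-congʳ (*-congʳ (pow-double-C2-suc k))) (poch-next a u N k)) ⟩
    u * (Z * A * Fk * poch w q M) + Z * (u * u) * (a * A) * (Fk * (1# - pow q M)) * poch (w * q) q (pred M)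
      ≈⟨ solve 8 (λ u Z A Fk a p₀ v p₁ → u :* (Z :* A :* Fk :* p₀) :+ Z :* (u :* u) :* (a :* A) :* (Fk :* (:1 :- v)) :* p₁
                                          := Z :* (A :* u) :* Fk :* (p₀ :+ a :* u :* (:1 :- v) :* p₁))
           refl u Z A Fk a (poch w q M) (pow q M) (poch (w * q) q (pred M)) ⟩
    Z * (A * u) * Fk * (poch w q M + w * (1# - pow q M) * poch (w * q) q (pred M))
      ≈⟨ *-congˡ (poch-absorb w q M) ⟩
    Z * (A * u) * Fk * poch (w * q) q M
      ≈⟨ *-cong (*-congʳ (*-congˡ (sym (pow-* a q k))))
                (poch-cong q M (solve 3 (λ a u q → a :* u :* q := a :* q :* u) refl a u q)) ⟩
    Z * pow (a * q) k * Fk * poch (a * q * u) q M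
      ∎
    where
    u = pow q k
    w = a * u
    M = N ∸ k
    Z = pow q (2 *ℕ (k C 2))
    A = pow a k
    Fk = falling N k
    p′ = poch (a * (q * u)) q (N ∸ suc k)

  expansion₁ : ∀ N n a → poch (a * pow q n) q N ≈ sumTo n (λ k → gauss n k * term₁ N a k)
  expansion₁ N zero    a = solve 1 (λ p → p := :1 :* (:1 :* :1 :* :1 :* p)) refl (poch (a * 1#) q N)
  expansion₁ N (suc n) a = begin
    poch (a * (q * pow q n)) q N                  ≈⟨ poch-cong q N (sym (*-assoc _ _ _)) ⟩
    poch (a * q * pow q n) q N                    ≈⟨ expansion₁ N n (a * q) ⟩
    sumTo n (λ k → gauss n k * term₁ N (a * q) k) ≈⟨ sum-cong n split ⟩
    sumTo n (λ k → gauss n k * pow q k * term₁ N a k + gauss n k * term₁ N a (suc k))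
      ≈⟨ resum n (λ k → gauss n k * pow q k) (gauss n) (gauss (suc n)) (term₁ N a)
           (trans (*-congʳ (gauss-vanish n (suc n) (ℕₚ.n<1+n n))) (zeroˡ _))
           (sym (trans (*-identityʳ _) (gauss-0 n)))
           (λ k → +-congʳ (*-comm _ _)) ⟩
    sumTo (suc n) (λ k → gauss (suc n) k * term₁ N a k)
      ∎
    where
    split : ∀ k → gauss n k * term₁ N (a * q) k ≈ gauss n k * pow q k * term₁ N a k + gauss n k * term₁ N a (suc k)
    split k = trans (*-congˡ (sym (term₁-recurrence N a k)))
                    (solve 4 (λ g u x y → g :* (u :* x :+ y) := g :* u :* x :+ g :* y) refl _ _ _ _)

  term₂ : ℕ → ℕ → Carrier → ℕ → Carrier
  term₂ N n b k = pow q (k C 2) * pow (- b) k * falling N k * poch (b * pow q n) q (N ∸ k)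

  term₂-recurrence : ∀ N n b k → k ≤ n →
                     term₂ N (suc n) b k + pow q (n ∸ k) * term₂ N (suc n) b (suc k) ≈ term₂ N n b k
  term₂-recurrence N n b k k≤n = begin
    Zc * B * Fk * poch (b * (q * qn)) q M + w * (pow q (suc k C 2) * (- b * B) * (Fk * (1# - v)) * p′)
      ≈⟨ +-cong (*-congˡ (poch-cong q M (solve 3 (λ b q t → b :* (q :* t) := b :* t :* q) refl b q qn)))
                (*-congˡ (*-cong (*-congʳ (*-congʳ (pow-C2-suc k))) (poch-next b qn N k))) ⟩
    Zc * B * Fk * P₀ + w * (Zc * u * (- b * B) * (Fk * (1# - v)) * P₁)
      ≈⟨ solve 9 (λ Zc B Fk P₀ b w u v P₁ → Zc :* B :* Fk :* P₀ :+ w :* (Zc :* u :* (:- b :* B) :* (Fk :* (:1 :- v)) :* P₁)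
                                            := Zc :* B :* Fk :* P₀ :- (w :* u) :* (Zc :* b :* B :* Fk :* (:1 :- v) :* P₁))
           refl Zc B Fk P₀ b w u v P₁ ⟩
    Zc * B * Fk * P₀ - (w * u) * (Zc * b * B * Fk * (1# - v) * P₁)
      ≈⟨ +-cong (*-congˡ (sym (poch-absorb (b * qn) q M))) (-‿cong (*-congʳ w*u≈qn)) ⟩
    Zc * B * Fk * (poch (b * qn) q M + b * qn * (1# - v) * P₁) - qn * (Zc * b * B * Fk * (1# - v) * P₁)
      ≈⟨ solve 8 (λ Zc B Fk x b qn v P₁ → Zc :* B :* Fk :* (x :+ b :* qn :* (:1 :- v) :* P₁)
                                           :- qn :* (Zc :* b :* B :* Fk :* (:1 :- v) :* P₁)
                                         := Zc :* B :* Fk :* x)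
           refl Zc B Fk (poch (b * qn) q M) b qn v P₁ ⟩
    Zc * B * Fk * poch (b * qn) q M
      ∎
    where
    u = pow q k
    qn = pow q n
    w = pow q (n ∸ k)
    M = N ∸ k
    v = pow q M
    Zc = pow q (k C 2)
    B = pow (- b) k
    Fk = falling N k
    P₀ = poch (b * qn * q) q M
    P₁ = poch (b * qn * q) q (pred M)
    p′ = poch (b * (q * qn)) q (N ∸ suc k)
    w*u≈qn : w * u ≈ qn
    w*u≈qn = trans (sym (pow-+ q (n ∸ k) k)) (P.subst (λ t → pow q (n ∸ k +ℕ k) ≈ pow q t) (ℕₚ.m∸n+n≡m k≤n) refl)

  expansion₂ : ∀ N n b → poch b q N ≈ sumTo n (λ k → gauss n k * term₂ N n b k)
  expansion₂ N zero    b = trans (poch-cong q N (sym (*-identityʳ b)))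
                                 (solve 1 (λ p → p := :1 :* (:1 :* :1 :* :1 :* p)) refl (poch (b * 1#) q N))
  expansion₂ N (suc n) b = begin
    poch b q N                                 ≈⟨ expansion₂ N n b ⟩
    sumTo n (λ k → gauss n k * term₂ N n b k)  ≈⟨ sum-cong≤ n split ⟩
    sumTo n (λ k → gauss n k * t k + gauss n k * pow q (n ∸ k) * t (suc k))
      ≈⟨ resum n (gauss n) (λ k → gauss n k * pow q (n ∸ k)) (gauss (suc n)) t
           (gauss-vanish n (suc n) (ℕₚ.n<1+n n))
           (sym (gauss-0 n))
           (λ k → trans (gauss-pascal₂ n k) (+-congˡ (*-comm _ _))) ⟩
    sumTo (suc n) (λ k → gauss (suc n) k * t k)
      ∎
    where
    t : ℕ → Carrier
    t = term₂ N (suc n) b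
    split : ∀ k → k ≤ n → gauss n k * term₂ N n b k ≈ gauss n k * t k + gauss n k * pow q (n ∸ k) * t (suc k)
    split k k≤n = trans (*-congˡ (sym (term₂-recurrence N n b k k≤n)))
                        (solve 4 (λ g x w y → g :* (x :+ w :* y) := g :* x :+ g :* w :* y) refl _ _ _ _)

  -- the second expansion for b = a q^{-n}
  expansion₂⁻¹ : ¬ (q ≈ 0#) → ∀ N n a →
    poch (a * pow (q ⁻¹) n) q N
      ≈ sumTo n (λ k → gauss n k * ((pow q (k C 2) * pow (q ⁻¹) (n *ℕ k)) * pow (- a) k * falling N k * poch a q (N ∸ k)))
  expansion₂⁻¹ q≉0 N n a = trans (expansion₂ N n b) (sum-cong n (λ k → *-congˡ (rewrite-term k)))
    where
    open import Algebra.Properties.Ring ring using (-‿distribˡ-*)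
    b = a * pow (q ⁻¹) n
    b*qⁿ≈a : b * pow q n ≈ a
    b*qⁿ≈a = begin
      a * pow (q ⁻¹) n * pow q n   ≈⟨ *-assoc _ _ _ ⟩
      a * (pow (q ⁻¹) n * pow q n) ≈⟨ *-congˡ (sym (pow-* (q ⁻¹) q n)) ⟩
      a * pow (q ⁻¹ * q) n         ≈⟨ *-congˡ (pow-cong n (trans (*-comm _ _) (⁻¹-inv q q≉0))) ⟩
      a * pow 1# n                 ≈⟨ *-congˡ (pow-1# n) ⟩
      a * 1#                       ≈⟨ *-identityʳ a ⟩
      a                            ∎
    rewrite-term : ∀ k → term₂ N n b k
                         ≈ (pow q (k C 2) * pow (q ⁻¹) (n *ℕ k)) * pow (- a) k * falling N k * poch a q (N ∸ k)
    rewrite-term k = begin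
      pow q (k C 2) * pow (- b) k * falling N k * poch (b * pow q n) q (N ∸ k)
        ≈⟨ *-cong (*-congʳ (*-congˡ (trans (pow-cong k (-‿distribˡ-* a (pow (q ⁻¹) n)))
                                      (trans (pow-* (- a) _ k) (*-congˡ (pow-pow (q ⁻¹) n k))))))
                  (poch-cong q (N ∸ k) b*qⁿ≈a) ⟩
      pow q (k C 2) * (pow (- a) k * pow (q ⁻¹) (n *ℕ k)) * falling N k * poch a q (N ∸ k)
        ≈⟨ solve 5 (λ z x y f p → z :* (x :* y) :* f :* p := z :* y :* x :* f :* p) refl _ _ _ _ _ ⟩
      (pow q (k C 2) * pow (q ⁻¹) (n *ℕ k)) * pow (- a) k * falling N k * poch a q (N ∸ k)
        ∎

module ShiftCoefficients {c ℓ : Level} (F : Field c ℓ) where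
  open Field F using (0#)
  open FieldOps F

  shiftX-≤ : ∀ t (s : Series) m r → t ≤ m → shiftX t s m r ≡ s (m ∸ t) r
  shiftX-≤ zero    s m       r _         = P.refl
  shiftX-≤ (suc t) s (suc m) r (s≤s t≤m) = shiftX-≤ t s m r t≤m

  shiftX-> : ∀ t (s : Series) m r → m < t → shiftX t s m r ≡ 0#
  shiftX-> (suc t) s zero    r _         = P.refl
  shiftX-> (suc t) s (suc m) r (s≤s m<t) = shiftX-> t s m r m<t

  shiftY-≤ : ∀ t (s : Series) m r → t ≤ r → shiftY t s m r ≡ s m (r ∸ t)
  shiftY-≤ zero    s m r       _         = P.refl
  shiftY-≤ (suc t) s m (suc r) (s≤s t≤r) = shiftY-≤ t s m r t≤r

  shiftY-> : ∀ t (s : Series) m r → r < t → shiftY t s m r ≡ 0#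
  shiftY-> (suc t) s m zero    _         = P.refl
  shiftY-> (suc t) s m (suc r) (s≤s r<t) = shiftY-> t s m r r<t

module Transfer {c ℓ : Level} (F : Field c ℓ) (q cc : Field.Carrier F) where
  open Field F hiding (zero)
  open FieldOps F
  open FieldFacts F
  open Gaussian F q
  open ShiftCoefficients F

  K : Carrier → Carrier → ℕ → ℕ → Carrier
  K b b' m r = poch b q m * poch b' q r * (poch q q m * poch q q r * poch cc q (m +ℕ r)) ⁻¹

  Φ1-coefficient : ∀ A b b' m r → Φ1 A b b' cc q m r ≈ K b b' m r * poch A q (m +ℕ r)
  Φ1-coefficient A b b' m r = solve 4 (λ a x y d → a :* x :* y :* d := x :* y :* d :* a) refl _ _ _ _

  module _ (q-regular : ∀ j → ¬ ((1# - pow q (suc j)) ≈ 0#))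
           (c-regular : ∀ j → ¬ ((1# - cc * pow q j) ≈ 0#)) where

    poch-q≉0 : ∀ n → ¬ (poch q q n ≈ 0#)
    poch-q≉0 n = prod-nz n _ q-regular

    poch-c≉0 : ∀ n → ¬ (poch cc q n ≈ 0#)
    poch-c≉0 n = prod-nz n _ c-regular

    poch-cqᵏ≉0 : ∀ k n → ¬ (poch (cc * pow q k) q n ≈ 0#)
    poch-cqᵏ≉0 k n = prod-nz n _ (λ j → nz-resp (+-congˡ (-‿cong (trans (*-congˡ (pow-+ q k j)) (sym (*-assoc _ _ _)))))
                                                (c-regular (k +ℕ j)))

    gauss≉0 : ∀ n k → k ≤ n → ¬ (gauss n k ≈ 0#)
    gauss≉0 n k k≤n = nz-factor {y = poch q q k} refl (nz-factor (gauss-poch n k k≤n) (poch-q≉0 n))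

    qbin≈gauss : ∀ n k → k ≤ n → qbin q n k ≈ gauss n k
    qbin≈gauss n k k≤n = begin
      poch q q n * pk ⁻¹ * pnk ⁻¹                  ≈⟨ *-congʳ (*-congʳ (sym (gauss-poch n k k≤n))) ⟩
      gauss n k * pk * pnk * pk ⁻¹ * pnk ⁻¹        ≈⟨ solve 5 (λ g a b c d → g :* a :* b :* c :* d := g :* (a :* c) :* (b :* d))
                                                         refl _ _ _ _ _ ⟩
      gauss n k * (pk * pk ⁻¹) * (pnk * pnk ⁻¹)    ≈⟨ *-cong (*-congˡ (⁻¹-inv pk (poch-q≉0 k)))
                                                              (⁻¹-inv pnk (poch-q≉0 (n ∸ k))) ⟩
      gauss n k * 1# * 1#                          ≈⟨ trans (*-identityʳ _) (*-identityʳ _) ⟩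
      gauss n k                                    ∎
      where
      pk = poch q q k
      pnk = poch q q (n ∸ k)

    -- Along k = j + i (j ≤ m, i ≤ r) the denominator of K b b' m r splits as
    -- G m j · G r i · (q;q)_i (q;q)_j (c;q)_k · D′, where D′ is the denominator
    -- of the x^{m-j} y^{r-i} coefficient of Φ⁽¹⁾[· ; ·, · ; c q^k].
    denominator-split : ∀ m r k i → i ≤ k → k ∸ i ≤ m → i ≤ r →
      (poch q q m * poch q q r * poch cc q (m +ℕ r)) ⁻¹
        ≈ (gauss m (k ∸ i) * gauss r i) ⁻¹
          * ((poch q q i) ⁻¹ * (poch q q (k ∸ i)) ⁻¹ * (poch cc q k) ⁻¹
             * (poch q q (m ∸ (k ∸ i)) * poch q q (r ∸ i) * poch (cc * pow q k) q ((m ∸ (k ∸ i)) +ℕ (r ∸ i))) ⁻¹)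
    denominator-split m r k i i≤k j≤m i≤r = begin
      (poch q q m * poch q q r * poch cc q (m +ℕ r)) ⁻¹
        ≈⟨ ⁻¹-cong (*-cong (*-cong (sym (gauss-poch m j j≤m)) (sym (gauss-poch r i i≤r)))
                           (poch-∸ cc q k (m +ℕ r) (Exponents.k≤m+r m r k i i≤k j≤m i≤r))) ⟩
      (Gm * pj * pm′ * (Gr * pi * pr′) * (pck * poch (cc * pow q k) q ((m +ℕ r) ∸ k))) ⁻¹
        ≡⟨ P.cong (λ t → (Gm * pj * pm′ * (Gr * pi * pr′) * (pck * poch (cc * pow q k) q t)) ⁻¹)
                  (Exponents.∸-split m r k i i≤k j≤m i≤r) ⟩
      (Gm * pj * pm′ * (Gr * pi * pr′) * (pck * pc′)) ⁻¹
        ≈⟨ ⁻¹-cong (solve 8 (λ Gm pj pm′ Gr pi pr′ pck pc′ → Gm :* pj :* pm′ :* (Gr :* pi :* pr′) :* (pck :* pc′)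
                                := Gm :* Gr :* (pi :* pj :* pck :* (pm′ :* pr′ :* pc′)))
                      refl Gm pj pm′ Gr pi pr′ pck pc′) ⟩
      (Gm * Gr * (pi * pj * pck * D′)) ⁻¹
        ≈⟨ inv-* (nz-* (gauss≉0 m j j≤m) (gauss≉0 r i i≤r)) (nz-* ijk≉0 D′≉0) ⟩
      (Gm * Gr) ⁻¹ * (pi * pj * pck * D′) ⁻¹
        ≈⟨ *-congˡ (trans (inv-* ijk≉0 D′≉0)
                          (*-congʳ (trans (inv-* ij≉0 (poch-c≉0 k)) (*-congʳ (inv-* (poch-q≉0 i) (poch-q≉0 j)))))) ⟩
      (Gm * Gr) ⁻¹ * (pi ⁻¹ * pj ⁻¹ * pck ⁻¹ * D′ ⁻¹)
        ∎
      where
      j = k ∸ i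
      m′ = m ∸ j
      r′ = r ∸ i
      Gm = gauss m j
      Gr = gauss r i
      pi = poch q q i
      pj = poch q q j
      pck = poch cc q k
      pm′ = poch q q m′
      pr′ = poch q q r′
      pc′ = poch (cc * pow q k) q (m′ +ℕ r′)
      D′ = pm′ * pr′ * pc′
      ij≉0 : ¬ (pi * pj ≈ 0#)
      ij≉0 = nz-* (poch-q≉0 i) (poch-q≉0 j)
      ijk≉0 : ¬ (pi * pj * pck ≈ 0#)
      ijk≉0 = nz-* ij≉0 (poch-c≉0 k)
      D′≉0 : ¬ (D′ ≈ 0#)
      D′≉0 = nz-* (nz-* (poch-q≉0 m′) (poch-q≉0 r′)) (poch-cqᵏ≉0 k (m′ +ℕ r′))

    summand-identity : ∀ b b' (Λ Z₁ Z₂ A′ : Carrier) m r k i → i ≤ k → k ∸ i ≤ m → i ≤ r →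
      Λ * qbin q k i * poch b q (k ∸ i) * poch b' q i * (poch cc q k) ⁻¹ * Z₁ * Z₂
        * (pow (pow q i) (m ∸ (k ∸ i)) * Φ1 A′ (b * pow q (k ∸ i)) (b' * pow q i) (cc * pow q k) q (m ∸ (k ∸ i)) (r ∸ i))
      ≈ K b b' m r * ((Λ * Z₁ * Z₂ * poch q q k * poch A′ q ((m +ℕ r) ∸ k)) * vandermonde-term m r k i)
    summand-identity b b' Λ Z₁ Z₂ A′ m r k i i≤k j≤m i≤r = begin
      Λ * (pk * pi ⁻¹ * pj ⁻¹) * pbj * pbi * pck ⁻¹ * Z₁ * Z₂ * (pow (pow q i) m′ * (pA * pB * pB′ * D′ ⁻¹))
        ≈⟨ *-congˡ (*-congʳ (pow-pow q i m′)) ⟩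
      Λ * (pk * pi ⁻¹ * pj ⁻¹) * pbj * pbi * pck ⁻¹ * Z₁ * Z₂ * (qⁱᵐ * (pA * pB * pB′ * D′ ⁻¹))
        ≈⟨ solve 14 (λ Λ pk ii ij pbj pbi ick Z₁ Z₂ qⁱᵐ pA pB pB′ iD →
              Λ :* (pk :* ii :* ij) :* pbj :* pbi :* ick :* Z₁ :* Z₂ :* (qⁱᵐ :* (pA :* pB :* pB′ :* iD))
              := Λ :* pk :* Z₁ :* Z₂ :* pbj :* pbi :* pA :* pB :* pB′ :* qⁱᵐ :* (ii :* ij :* ick :* iD))
            refl Λ pk (pi ⁻¹) (pj ⁻¹) pbj pbi (pck ⁻¹) Z₁ Z₂ qⁱᵐ pA pB pB′ (D′ ⁻¹) ⟩
      Num * E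
        ≈⟨ sym (trans (*-congʳ (⁻¹-inv GG GG≉0)) (*-identityˡ _)) ⟩
      GG * GG ⁻¹ * (Num * E)
        ≈⟨ solve 14 (λ pbj pB pbi pB′ iG E Λ Z₁ Z₂ pk pA Gm Gr qⁱᵐ →
              (Gm :* Gr) :* iG :* (Λ :* pk :* Z₁ :* Z₂ :* pbj :* pbi :* pA :* pB :* pB′ :* qⁱᵐ :* E)
              := pbj :* pB :* (pbi :* pB′) :* (iG :* E) :* (Λ :* Z₁ :* Z₂ :* pk :* pA :* (Gm :* Gr :* qⁱᵐ)))
            refl pbj pB pbi pB′ (GG ⁻¹) E Λ Z₁ Z₂ pk pA Gm Gr qⁱᵐ ⟩
      pbj * pB * (pbi * pB′) * (GG ⁻¹ * E) * (Λ * Z₁ * Z₂ * pk * pA * (Gm * Gr * qⁱᵐ))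
        ≈⟨ *-cong (*-cong (*-cong (sym (poch-∸ b q j m j≤m)) (sym (poch-∸ b' q i r i≤r)))
                          (sym (denominator-split m r k i i≤k j≤m i≤r)))
                  (*-congʳ (*-congˡ (reflexive (P.cong (poch A′ q) (P.sym (Exponents.∸-split m r k i i≤k j≤m i≤r)))))) ⟩
      K b b' m r * ((Λ * Z₁ * Z₂ * pk * poch A′ q ((m +ℕ r) ∸ k)) * vandermonde-term m r k i)
        ∎
      where
      j = k ∸ i
      m′ = m ∸ j
      r′ = r ∸ i
      pk = poch q q k
      pi = poch q q i
      pj = poch q q j
      pbj = poch b q j
      pbi = poch b' q i
      pck = poch cc q k
      qⁱᵐ = pow q (i *ℕ m′)
      pA = poch A′ q (m′ +ℕ r′)
      pB = poch (b * pow q j) q m′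
      pB′ = poch (b' * pow q i) q r′
      D′ = poch q q m′ * poch q q r′ * poch (cc * pow q k) q (m′ +ℕ r′)
      Gm = gauss m j
      Gr = gauss r i
      GG = Gm * Gr
      GG≉0 : ¬ (GG ≈ 0#)
      GG≉0 = nz-* (gauss≉0 m j j≤m) (gauss≉0 r i i≤r)
      E = pi ⁻¹ * pj ⁻¹ * pck ⁻¹ * D′ ⁻¹
      Num = Λ * pk * Z₁ * Z₂ * pbj * pbi * pA * pB * pB′ * qⁱᵐ

    module Lift (n : ℕ) (b b' : Carrier) (Z₁ Z₂ A′ : ℕ → Carrier) where

      coeff : ℕ → ℕ → Carrier
      coeff k i = qbin q n k * qbin q k i * poch b q (k ∸ i) * poch b' q i * (poch cc q k) ⁻¹ * Z₁ k * Z₂ k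

      -- x^{k-i} y^i Φ⁽¹⁾[A′ k; b q^{k-i}, b' q^i; c q^k; x q^i, y]
      shifted : ℕ → ℕ → Series
      shifted k i = shiftX (k ∸ i) (shiftY i (dilateX (pow q i)
                      (Φ1 (A′ k) (b * pow q (k ∸ i)) (b' * pow q i) (cc * pow q k) q)))

      weight : ℕ → ℕ → ℕ → Carrier
      weight m r k = qbin q n k * Z₁ k * Z₂ k * poch q q k * poch (A′ k) q ((m +ℕ r) ∸ k)

      -- summands outside the support (j > m or i > r) vanish on both sides
      vanishing-summand : ∀ m r k i → vandermonde-term m r k i ≈ 0# →
                          coeff k i * 0# ≈ K b b' m r * (weight m r k * vandermonde-term m r k i)
      vanishing-summand m r k i v≈0 =
        trans (zeroʳ _) (sym (trans (*-congˡ (trans (*-congˡ v≈0) (zeroʳ _))) (zeroʳ _)))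

      summand-coefficient : ∀ m r k i → i ≤ k →
        coeff k i * shifted k i m r ≈ K b b' m r * (weight m r k * vandermonde-term m r k i)
      summand-coefficient m r k i i≤k with (k ∸ i) ℕₚ.≤? m | i ℕₚ.≤? r
      ... | yes j≤m | yes i≤r = begin
        coeff k i * shifted k i m r
          ≡⟨ P.cong (coeff k i *_) (P.trans (shiftX-≤ (k ∸ i) _ m r j≤m) (shiftY-≤ i _ (m ∸ (k ∸ i)) r i≤r)) ⟩
        coeff k i * (pow (pow q i) (m ∸ (k ∸ i))
                      * Φ1 (A′ k) (b * pow q (k ∸ i)) (b' * pow q i) (cc * pow q k) q (m ∸ (k ∸ i)) (r ∸ i))
          ≈⟨ summand-identity b b' (qbin q n k) (Z₁ k) (Z₂ k) (A′ k) m r k i i≤k j≤m i≤r ⟩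
        K b b' m r * (weight m r k * vandermonde-term m r k i)
          ∎
      ... | no j≰m | _ =
        trans (reflexive (P.cong (coeff k i *_) (shiftX-> (k ∸ i) _ m r (ℕₚ.≰⇒> j≰m))))
              (vanishing-summand m r k i
                 (trans (*-congʳ (trans (*-congʳ (gauss-vanish m (k ∸ i) (ℕₚ.≰⇒> j≰m))) (zeroˡ _))) (zeroˡ _)))
      ... | yes j≤m | no i≰r =
        trans (reflexive (P.cong (coeff k i *_)
                            (P.trans (shiftX-≤ (k ∸ i) _ m r j≤m) (shiftY-> i _ (m ∸ (k ∸ i)) r (ℕₚ.≰⇒> i≰r)))))
              (vanishing-summand m r k i
                 (trans (*-congʳ (trans (*-congˡ (gauss-vanish r i (ℕₚ.≰⇒> i≰r))) (zeroʳ _))) (zeroˡ _)))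

      Φ1-transfer : ∀ A →
        (∀ N → poch A q N ≈ sumTo n (λ k → gauss n k * (Z₁ k * Z₂ k * falling N k * poch (A′ k) q (N ∸ k)))) →
        Φ1 A b b' cc q ≋ sumS n (λ k → sumS k (λ i → scaleS (coeff k i) (shifted k i)))
      Φ1-transfer A expansion m r = begin
        Φ1 A b b' cc q m r
          ≈⟨ Φ1-coefficient A b b' m r ⟩
        K b b' m r * poch A q N
          ≈⟨ *-congˡ (expansion N) ⟩
        K b b' m r * sumTo n (λ k → gauss n k * (Z₁ k * Z₂ k * falling N k * poch (A′ k) q (N ∸ k)))
          ≈⟨ *-congˡ (sum-cong≤ n regroup) ⟩
        K b b' m r * sumTo n (λ k → weight m r k * gauss N k)
          ≈⟨ *-congˡ (sum-cong n (λ k → *-congˡ (sym (q-vandermonde m r k)))) ⟩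
        K b b' m r * sumTo n (λ k → weight m r k * sumTo k (vandermonde-term m r k))
          ≈⟨ trans (sum-*ˡ n _ _) (sum-cong n (λ k → *-congˡ (sum-*ˡ k (weight m r k) (vandermonde-term m r k)))) ⟩
        sumTo n (λ k → K b b' m r * sumTo k (λ i → weight m r k * vandermonde-term m r k i))
          ≈⟨ sum-cong n (λ k → sum-*ˡ k (K b b' m r) _) ⟩
        sumTo n (λ k → sumTo k (λ i → K b b' m r * (weight m r k * vandermonde-term m r k i)))
          ≈⟨ sum-cong n (λ k → sum-cong≤ k (λ i i≤k → sym (summand-coefficient m r k i i≤k))) ⟩
        sumTo n (λ k → sumTo k (λ i → coeff k i * shifted k i m r))
          ∎
        where
        N = m +ℕ r
        -- (q;q)_k G N k = falling N k, and [n k] = G n k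
        regroup : ∀ k → k ≤ n →
          gauss n k * (Z₁ k * Z₂ k * falling N k * poch (A′ k) q (N ∸ k)) ≈ weight m r k * gauss N k
        regroup k k≤n = begin
          gauss n k * (Z₁ k * Z₂ k * falling N k * poch (A′ k) q (N ∸ k))
            ≈⟨ *-cong (sym (qbin≈gauss n k k≤n)) (*-congʳ (*-congˡ (sym (gauss-falling N k)))) ⟩
          qbin q n k * (Z₁ k * Z₂ k * (gauss N k * poch q q k) * poch (A′ k) q (N ∸ k))
            ≈⟨ solve 6 (λ Q z₁ z₂ g p P → Q :* (z₁ :* z₂ :* (g :* p) :* P) := Q :* z₁ :* z₂ :* p :* P :* g)
                 refl _ _ _ _ _ _ ⟩
          weight m r k * gauss N k
            ∎

-- The theorem: the transfer principle applied to the two Pochhammer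
-- expansions (the second with b = a q^{-n}).  The argument works for every
-- n.
theorem2 : ∀ {c ℓ : Level} (F : Field c ℓ) →
    let open Field F
        open FieldOps F
    in ∀ (q a b b' cc : Carrier) →
       (∀ j → ¬ ((1# - pow q (suc j)) ≈ 0#)) →
       (∀ j → ¬ ((1# - cc * pow q j) ≈ 0#)) →
       ∀ (n : ℕ) → 1 ≤ n →
       (Φ1 (a * pow q n) b b' cc q
          ≋ sumS n (λ k → sumS k (λ i →
              scaleS (qbin q n k * qbin q k i
                        * poch b q (k ∸ i) * poch b' q i * (poch cc q k) ⁻¹
                        * pow q (2 *ℕ (k C 2)) * pow a k)
                (shiftX (k ∸ i) (shiftY i (dilateX (pow q i)
                  (Φ1 (a * pow q k) (b * pow q (k ∸ i)) (b' * pow q i) (cc * pow q k) q)))))))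
       ×
       (¬ (q ≈ 0#) →
        Φ1 (a * pow (q ⁻¹) n) b b' cc q
          ≋ sumS n (λ k → sumS k (λ i →
              scaleS (qbin q n k * qbin q k i
                        * poch b q (k ∸ i) * poch b' q i * (poch cc q k) ⁻¹
                        * (pow q (k C 2) * pow (q ⁻¹) (n *ℕ k)) * pow (- a) k)
                (shiftX (k ∸ i) (shiftY i (dilateX (pow q i)
                  (Φ1 a (b * pow q (k ∸ i)) (b' * pow q i) (cc * pow q k) q)))))))
theorem2 F q a b b' cc q-regular c-regular n _ = shift-up , shift-down
  where
  open Field F hiding (zero)
  open FieldOps F
  open Expansions F q
  open Transfer F q cc using (module Lift)

  shift-up = Lift.Φ1-transfer q-regular c-regular n b b'
               (λ k → pow q (2 *ℕ (k C 2))) (pow a) (λ k → a * pow q k)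
               (a * pow q n) (λ N → expansion₁ N n a)

  shift-down = λ q≉0 → Lift.Φ1-transfer q-regular c-regular n b b'
                 (λ k → pow q (k C 2) * pow (q ⁻¹) (n *ℕ k)) (pow (- a)) (λ _ → a)
                 (a * pow (q ⁻¹) n) (λ N → expansion₂⁻¹ q≉0 N n a)
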